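{- Let $P$ and $S$ be finite posets such that $S$ contains $W:=P\times\{a,b\}$ (with $a<b$, product order) as a subposet and, for every $p\in P$, $S_{<(p,b)}=W_{<(p,b)}$ and $S_{>(p,b)}=W_{>(p,b)}$. Let $Q$ be the poset obtained from $S$ by adding a new element $x$ whose only relations are $x<(p,b)$ for all $p\in P$. If $P$ is dismantlable, then $Q\setminus\{x\}\setminus\{(p,b):p\in P\}$ is obtained from $Q$ by a finite sequence of deletions of weak points (each a weak point of the current poset).
   Context: The product order on $P\times\{a,b\}$: $(p,c)\le(p',c')$ iff $p\le p'$ and $c\le c'$. For a finite poset $R$ and $y\in R$, $R_{<y}$ and $R_{>y}$ are the subposets of elements strictly below/above $y$; $y$ is irreducible if $R_{<y}$ has a maximum or $R_{>y}$ has a minimum. $R$ is dismantlable if $R=\{x_1,\dots,x_n\}$, $n\ge1$, with each $x_i$ ($2\le i\le n$) irreducible in the subposet $\{x_1,\dots,x_i\}$. A point $y$ is a weak point of $R$ if $R_{<y}$ or $R_{>y}$ is dismantlable. A subposet carries the induced order. -}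

module Defs where

open import Data.Bool using (Bool; true; false)
open import Data.Empty using (⊥)
open import Data.Unit using (⊤)
open import Data.Product using (Σ; ∃; _×_; _,_)
open import Data.Sum using (_⊎_)
open import Data.Maybe using (Maybe; just; nothing)
open import Data.List using (List; []; _∷_)
open import Data.List.Membership.Propositional using (_∈_)
open import Data.List.Relation.Unary.Unique.Propositional using (Unique)
open import Relation.Binary.PropositionalEquality using (_≡_; _≢_)
open import Relation.Nullary using (¬_; Dec)
open import Relation.Unary using (Pred; _≐_)
open import Level using (0ℓ)

record FinPoset : Set₁ where
  field
    Carrier   : Set
    _≤_       : Carrier → Carrier → Set
    ≤-refl    : ∀ x → x ≤ x
    ≤-antisym : ∀ {x y} → x ≤ y → y ≤ x → x ≡ y
    ≤-trans   : ∀ {x y z} → x ≤ y → y ≤ z → x ≤ z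
    _≤?_      : ∀ x y → Dec (x ≤ y)
    _≟_       : ∀ (x y : Carrier) → Dec (x ≡ y)
    elems     : List Carrier
    complete  : ∀ x → x ∈ elems

-- Notions relative to an ambient order _≤_ on a type A.
-- Subposets are subsets (predicates) with the induced order.
module Order {A : Set} (_≤_ : A → A → Set) where

  _<_ : A → A → Set
  x < y = x ≤ y × x ≢ y

  Below : Pred A 0ℓ → A → Pred A 0ℓ
  Below R y z = R z × z < y

  Above : Pred A 0ℓ → A → Pred A 0ℓ
  Above R y z = R z × y < z

  HasMax : Pred A 0ℓ → Set
  HasMax V = Σ A λ m → V m × (∀ z → V z → z ≤ m)

  HasMin : Pred A 0ℓ → Set
  HasMin V = Σ A λ m → V m × (∀ z → V z → m ≤ z)

  Irreducible : Pred A 0ℓ → A → Set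
  Irreducible R y = HasMax (Below R y) ⊎ HasMin (Above R y)

  ListSet : List A → Pred A 0ℓ
  ListSet xs z = z ∈ xs

  -- DismChain (x_n ∷ … ∷ x_1): the list is the enumeration in REVERSE order;
  -- every x_i with i ≥ 2 is irreducible in {x_1,…,x_i}.  Nonempty by construction.
  data DismChain : List A → Set where
    one  : ∀ x → DismChain (x ∷ [])
    cons : ∀ x y ys → Irreducible (ListSet (x ∷ y ∷ ys)) x →
           DismChain (y ∷ ys) → DismChain (x ∷ y ∷ ys)

  Dismantlable : Pred A 0ℓ → Set
  Dismantlable R = Σ (List A) λ xs → Unique xs × (ListSet xs ≐ R) × DismChain xs

  WeakPoint : Pred A 0ℓ → A → Set
  WeakPoint R y = R y × (Dismantlable (Below R y) ⊎ Dismantlable (Above R y))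

  Delete : Pred A 0ℓ → A → Pred A 0ℓ
  Delete R y z = R z × z ≢ y

  data WeakDeletions (R : Pred A 0ℓ) (T : Pred A 0ℓ) : Set where
    done : R ≐ T → WeakDeletions R T
    step : ∀ y → WeakPoint R y → WeakDeletions (Delete R y) T → WeakDeletions R T

-- Product order on P × {a,b}, with a = false < b = true.
_≤B_ : Bool → Bool → Set
false ≤B _     = ⊤
true  ≤B false = ⊥
true  ≤B true  = ⊤

module _ (P : FinPoset) where
  open FinPoset P renaming (Carrier to |P|; _≤_ to _≤P_)

  W : Set
  W = |P| × Bool

  _≤W_ : W → W → Set
  (p , c) ≤W (p' , c') = p ≤P p' × c ≤B c'

-- Hypotheses: S contains W as a subposet via an order embedding e,
-- and S_{<(p,b)} = W_{<(p,b)}, S_{>(p,b)} = W_{>(p,b)} for every p.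
record Setup (P S : FinPoset) : Set where
  open FinPoset S renaming (Carrier to |S|; _≤_ to _≤S_)
  open FinPoset P renaming (Carrier to |P|)
  field
    e        : W P → |S|
    e-inj    : ∀ u v → e u ≡ e v → u ≡ v
    e-order  : ∀ u v → (e u ≤S e v → _≤W_ P u v) × (_≤W_ P u v → e u ≤S e v)
    below-pb : ∀ p s → (Order._<_ _≤S_ s (e (p , true)) →
                          Σ (W P) λ w → s ≡ e w × Order._<_ (_≤W_ P) w (p , true))
                     × ((Σ (W P) λ w → s ≡ e w × Order._<_ (_≤W_ P) w (p , true)) →
                          Order._<_ _≤S_ s (e (p , true)))
    above-pb : ∀ p s → (Order._<_ _≤S_ (e (p , true)) s →
                          Σ (W P) λ w → s ≡ e w × Order._<_ (_≤W_ P) (p , true) w)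
                     × ((Σ (W P) λ w → s ≡ e w × Order._<_ (_≤W_ P) (p , true) w) →
                          Order._<_ _≤S_ (e (p , true)) s)

module _ {P S : FinPoset} (σ : Setup P S) where
  open FinPoset S renaming (Carrier to |S|; _≤_ to _≤S_)
  open FinPoset P renaming (Carrier to |P|)
  open Setup σ

  -- Q = S plus a new element x = nothing, whose only relations are x < (p,b).
  _≤Q_ : Maybe |S| → Maybe |S| → Set
  just s  ≤Q just t  = s ≤S t
  just s  ≤Q nothing = ⊥
  nothing ≤Q nothing = ⊤
  nothing ≤Q just t  = Σ |P| λ p → t ≡ e (p , true)

  AllQ : Pred (Maybe |S|) 0ℓ
  AllQ _ = ⊤

  Target : Pred (Maybe |S|) 0ℓ
  Target q = Σ |S| λ s → q ≡ just s × ¬ (Σ |P| λ p → s ≡ e (p , true))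

AllP : (P : FinPoset) → Pred (FinPoset.Carrier P) 0ℓ
AllP P _ = ⊤

-- The new point x is weak, because Q_{>x} = {(p,b) : p ∈ P} is a copy of the
-- dismantlable poset P.  After removing it, the points (p,b) are removed in the
-- order of a linear extension of P.  When (p,b) is removed, every (q,b) with
-- q < p is already gone, so by the hypothesis on S_{<(p,b)} what remains below
-- (p,b) is {(q,a) : q ≤ p}; it has the maximum (p,a), and a finite poset with a
-- maximum is dismantlable.
module Submission where

open import Defs
open import Data.Bool using (true; false)
open import Data.Empty using (⊥-elim)
open import Data.Unit using (tt)
open import Data.Product using (Σ; _×_; _,_; proj₁; proj₂)
open import Data.Sum using (inj₁; inj₂)
import Data.Sum as Sum
open import Data.Maybe using (Maybe; just; nothing)
open import Data.Maybe.Properties using (just-injective)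
import Data.Nat as ℕ
import Data.Nat.Properties as ℕ
open import Data.List using (List; []; _∷_; _++_; filter; map; length)
open import Data.List.Properties using (filter-notAll)
open import Data.List.Relation.Unary.Any using (here; there)
import Data.List.Relation.Unary.Any as Any
open import Data.List.Relation.Unary.Any.Properties using (¬Any[])
open import Data.List.Relation.Unary.All using (All; []; _∷_)
import Data.List.Relation.Unary.All as All
open import Data.List.Relation.Unary.AllPairs using (AllPairs; []; _∷_)
import Data.List.Relation.Unary.AllPairs as AllPairs
import Data.List.Relation.Unary.AllPairs.Properties as AllPairs
open import Data.List.Membership.Propositional using (_∈_)
open import Data.List.Membership.Propositional.Properties
  using (∈-filter⁺; ∈-filter⁻; ∈-map⁺; ∈-map⁻; ∈-++⁺ˡ; ∈-++⁺ʳ; ∈-++⁻)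
import Data.List.Membership.DecPropositional as DecMembership
import Data.List.Relation.Unary.Unique.Propositional.Properties as Unique
open import Relation.Binary.PropositionalEquality using (_≡_; _≢_; refl; sym; trans; cong; subst)
open import Relation.Nullary using (Dec; yes; no; ¬_; ¬?)
open import Relation.Nullary.Decidable using (_×-dec_; _→-dec_; map′)
open import Relation.Unary using (Pred; _≐_)
open import Level using (0ℓ)

module _ {A : Set} (_≤_ : A → A → Set) where
  open Order _≤_

  dismantlable-resp-≐ : ∀ {V V′} → V ≐ V′ → Dismantlable V → Dismantlable V′
  dismantlable-resp-≐ (V⊆V′ , V′⊆V) (xs , unique , (xs⊆V , V⊆xs) , chain) =
    xs , unique , ((λ z∈ → V⊆V′ (xs⊆V z∈)) , (λ Vz → V⊆xs (V′⊆V Vz))) , chain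

  weakDeletions-resp-≐ : ∀ {R R′ T} → WeakDeletions R T → R ≐ R′ → WeakDeletions R′ T
  weakDeletions-resp-≐ (done (R⊆T , T⊆R)) (R⊆R′ , R′⊆R) =
    done ((λ R′z → R⊆T (R′⊆R R′z)) , (λ Tz → R⊆R′ (T⊆R Tz)))
  weakDeletions-resp-≐ {R} {R′} (step y (Ry , weak) rest) (R⊆R′ , R′⊆R) =
    step y (R⊆R′ Ry , Sum.map (dismantlable-resp-≐ below) (dismantlable-resp-≐ above) weak)
      (weakDeletions-resp-≐ rest ((λ (Rz , z≢y) → R⊆R′ Rz , z≢y) , (λ (R′z , z≢y) → R′⊆R R′z , z≢y)))
    where
    below : Below R y ≐ Below R′ y
    below = (λ (Rz , z<y) → R⊆R′ Rz , z<y) , (λ (R′z , z<y) → R′⊆R R′z , z<y)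
    above : Above R y ≐ Above R′ y
    above = (λ (Rz , y<z) → R⊆R′ Rz , y<z) , (λ (R′z , y<z) → R′⊆R R′z , y<z)

module Linearisation {A : Set} (_≼_ : A → A → Set) (_≼?_ : ∀ x y → Dec (x ≼ y))
  (≼-trans : ∀ {x y z} → x ≼ y → y ≼ z → x ≼ z)
  (≼-antisym : ∀ {x y} → x ≼ y → y ≼ x → x ≡ y)
  (_≟_ : ∀ (x y : A) → Dec (x ≡ y)) where

  Maximal : List A → A → Set
  Maximal xs y = y ∈ xs × (∀ {z} → z ∈ xs → y ≼ z → z ≡ y)

  maximal : ∀ x xs → Σ A (Maximal (x ∷ xs))
  maximal x [] = x , here refl , λ { (here z≡x) _ → z≡x ; (there ()) }
  maximal x (x′ ∷ xs) with maximal x′ xs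
  ... | y , y∈ , y-max with y ≼? x
  ...   | yes y≼x = x , here refl , λ where
            (here z≡x) _ → z≡x
            (there z∈) x≼z → let z≡y = y-max z∈ (≼-trans y≼x x≼z)
                             in trans z≡y (≼-antisym y≼x (subst (x ≼_) z≡y x≼z))
  ...   | no y⋠x = y , there y∈ , λ where
            (here z≡x) y≼z → ⊥-elim (y⋠x (subst (y ≼_) z≡x y≼z))
            (there z∈) y≼z → y-max z∈ y≼z

  Descending : List A → Set
  Descending = AllPairs (λ a b → ¬ a ≼ b)

  private
    ≢? : ∀ y z → Dec (z ≢ y)
    ≢? y z = ¬? (z ≟ y)

    linearise′ : ∀ n xs → length xs ℕ.≤ n →
                 Σ (List A) λ ys → (_∈ ys) ≐ (_∈ xs) × Descending ys
    linearise′ _ [] _ = [] , ((λ ()) , (λ ())) , []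
    linearise′ (ℕ.suc n) (x ∷ xs) |x∷xs|≤1+n with maximal x xs
    ... | y , y∈ , y-max with linearise′ n (filter (≢? y) (x ∷ xs)) shorter
      where
      shorter : length (filter (≢? y) (x ∷ xs)) ℕ.≤ n
      shorter = ℕ.≤-pred (ℕ.≤-trans
        (filter-notAll (≢? y) (x ∷ xs) (Any.map (λ y≡z z≢y → z≢y (sym y≡z)) y∈)) |x∷xs|≤1+n)
    ... | ys , (ys⊆rest , rest⊆ys) , descending =
      y ∷ ys , (⊆x∷xs , x∷xs⊆) , All.tabulate y⋠ ∷ descending
      where
      ⊆x∷xs : ∀ {z} → z ∈ y ∷ ys → z ∈ x ∷ xs
      ⊆x∷xs (here refl) = y∈
      ⊆x∷xs (there z∈) = proj₁ (∈-filter⁻ (≢? y) {xs = x ∷ xs} (ys⊆rest z∈))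
      x∷xs⊆ : ∀ {z} → z ∈ x ∷ xs → z ∈ y ∷ ys
      x∷xs⊆ {z} z∈ with z ≟ y
      ... | yes z≡y = here z≡y
      ... | no z≢y = there (rest⊆ys (∈-filter⁺ (≢? y) z∈ z≢y))
      y⋠ : ∀ {z} → z ∈ ys → ¬ y ≼ z
      y⋠ z∈ y≼z = let z∈x∷xs , z≢y = ∈-filter⁻ (≢? y) {xs = x ∷ xs} (ys⊆rest z∈) in z≢y (y-max z∈x∷xs y≼z)

  linearise : ∀ xs → Σ (List A) λ ys → (_∈ ys) ≐ (_∈ xs) × Descending ys
  linearise xs = linearise′ (length xs) xs ℕ.≤-refl

module OrderEmbedding {A B : Set} (_≤A_ : A → A → Set) (_≤B_ : B → B → Set) (f : A → B)
  (f-injective : ∀ {u v} → f u ≡ f v → u ≡ v)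
  (f-mono : ∀ {u v} → u ≤A v → f u ≤B f v)
  (f-reflects : ∀ {u v} → f u ≤B f v → u ≤A v) where

  private
    module A = Order _≤A_
    module B = Order _≤B_

  <-mono : ∀ {u v} → u A.< v → f u B.< f v
  <-mono (u≤v , u≢v) = f-mono u≤v , λ fu≡fv → u≢v (f-injective fu≡fv)

  <-reflects : ∀ {u v} → f u B.< f v → u A.< v
  <-reflects (fu≤fv , fu≢fv) = f-reflects fu≤fv , λ u≡v → fu≢fv (cong f u≡v)

  irreducible-map : ∀ {x} ys → A.Irreducible (A.ListSet ys) x →
                    B.Irreducible (B.ListSet (map f ys)) (f x)
  irreducible-map {x} ys (inj₁ (m , (m∈ , m<x) , m-max)) =
    inj₁ (f m , (∈-map⁺ f m∈ , <-mono m<x) , λ z (z∈ , z<fx) → bound z∈ z<fx)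
    where
    bound : ∀ {z} → z ∈ map f ys → z B.< f x → z ≤B f m
    bound z∈ z<fx with ∈-map⁻ f z∈
    ... | a , a∈ , refl = f-mono (m-max a (a∈ , <-reflects z<fx))
  irreducible-map {x} ys (inj₂ (m , (m∈ , x<m) , m-min)) =
    inj₂ (f m , (∈-map⁺ f m∈ , <-mono x<m) , λ z (z∈ , fx<z) → bound z∈ fx<z)
    where
    bound : ∀ {z} → z ∈ map f ys → f x B.< z → f m ≤B z
    bound z∈ fx<z with ∈-map⁻ f z∈
    ... | a , a∈ , refl = f-mono (m-min a (a∈ , <-reflects fx<z))

  dismChain-map : ∀ {xs} → A.DismChain xs → B.DismChain (map f xs)
  dismChain-map (A.one x) = B.one (f x)
  dismChain-map (A.cons x y ys irr chain) =
    B.cons (f x) (f y) (map f ys) (irreducible-map (x ∷ y ∷ ys) irr) (dismChain-map chain)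

  dismantlable-map : ∀ {V : Pred A 0ℓ} {V′ : Pred B 0ℓ} →
                     (∀ {b} → V′ b → Σ A λ a → V a × b ≡ f a) → (∀ {a} → V a → V′ (f a)) →
                     A.Dismantlable V → B.Dismantlable V′
  dismantlable-map {V} {V′} V′⊆fV fV⊆V′ (xs , unique , (xs⊆V , V⊆xs) , chain) =
    map f xs , Unique.map⁺ f-injective unique , (fxs⊆V′ , V′⊆fxs) , dismChain-map chain
    where
    fxs⊆V′ : ∀ {b} → b ∈ map f xs → V′ b
    fxs⊆V′ b∈ with ∈-map⁻ f b∈
    ... | a , a∈ , refl = fV⊆V′ (xs⊆V a∈)
    V′⊆fxs : ∀ {b} → V′ b → b ∈ map f xs
    V′⊆fxs V′b with V′⊆fV V′b
    ... | a , Va , refl = ∈-map⁺ f (V⊆xs Va)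

module _ (S : FinPoset) where
  open FinPoset S
  open Order _≤_
  open Linearisation _≤_ _≤?_ ≤-trans ≤-antisym _≟_

  module _ {m : Carrier} where

    m-upperCover : ∀ {y} ys → All (λ z → ¬ y ≤ z) ys → y < m →
                   HasMin (Above (ListSet (y ∷ ys ++ m ∷ [])) y)
    m-upperCover {y} ys y⋠ys y<m = m , (there (∈-++⁺ʳ ys (here refl)) , y<m) , m≤
      where
      m≤ : ∀ z → Above (ListSet (y ∷ ys ++ m ∷ [])) y z → m ≤ z
      m≤ z (here z≡y , _ , y≢z) = ⊥-elim (y≢z (sym z≡y))
      m≤ z (there z∈ , y≤z , _) with ∈-++⁻ ys z∈
      ... | inj₁ z∈ys = ⊥-elim (All.lookup y⋠ys z∈ys y≤z)
      ... | inj₂ (here refl) = ≤-refl m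

    dismChain-below-max : ∀ ys → Descending ys → All (_< m) ys → DismChain (ys ++ m ∷ [])
    dismChain-below-max [] _ _ = one m
    dismChain-below-max (y ∷ []) _ (y<m ∷ _) = cons y m [] (inj₂ (m-upperCover [] [] y<m)) (one m)
    dismChain-below-max (y ∷ y′ ∷ ys) (y⋠ ∷ descending) (y<m ∷ <m) =
      cons y y′ (ys ++ m ∷ []) (inj₂ (m-upperCover (y′ ∷ ys) y⋠ y<m))
        (dismChain-below-max (y′ ∷ ys) descending <m)

  dismantlable-withMax : (V : Pred Carrier 0ℓ) → (∀ z → Dec (V z)) → HasMax V → Dismantlable V
  dismantlable-withMax V V? (m , Vm , m-max) =
    ys ++ m ∷ [] , unique , (⊆V , V⊆) , dismChain-below-max ys descending below-m
    where
    others? = λ z → V? z ×-dec ¬? (z ≟ m)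
    linearised = linearise (filter others? elems)
    ys = proj₁ linearised
    ys⊆others = proj₁ (proj₁ (proj₂ linearised))
    others⊆ys = proj₂ (proj₁ (proj₂ linearised))
    descending = proj₂ (proj₂ linearised)

    below-m : All (_< m) ys
    below-m = All.tabulate λ z∈ →
      let _ , Vz , z≢m = ∈-filter⁻ others? {xs = elems} (ys⊆others z∈) in m-max _ Vz , z≢m

    unique : AllPairs _≢_ (ys ++ m ∷ [])
    unique = AllPairs.++⁺
      (AllPairs.map (λ a⋠b a≡b → a⋠b (subst (_ ≤_) a≡b (≤-refl _))) descending)
      ([] ∷ [])
      (All.map (λ (_ , z≢m) → z≢m ∷ []) below-m)

    ⊆V : ∀ {z} → z ∈ ys ++ m ∷ [] → V z
    ⊆V z∈ with ∈-++⁻ ys z∈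
    ... | inj₁ z∈ys = proj₁ (proj₂ (∈-filter⁻ others? {xs = elems} (ys⊆others z∈ys)))
    ... | inj₂ (here refl) = Vm

    V⊆ : ∀ {z} → V z → z ∈ ys ++ m ∷ []
    V⊆ {z} Vz with z ≟ m
    ... | yes refl = ∈-++⁺ʳ ys (here refl)
    ... | no z≢m = ∈-++⁺ˡ (others⊆ys (∈-filter⁺ others? (complete z) (Vz , z≢m)))

module _ {P S : FinPoset} (σ : Setup P S) where
  open FinPoset S using (_≟_) renaming (Carrier to |S|; _≤_ to _≤S_; _≤?_ to _≤S?_)
  open FinPoset P using ()
    renaming (Carrier to |P|; _≤_ to _≤P_; _≟_ to _≟P_; _≤?_ to _≤P?_; ≤-refl to ≤P-refl;
              ≤-trans to ≤P-trans; ≤-antisym to ≤P-antisym; elems to elemsP; complete to completeP)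
  open Setup σ
  open DecMembership _≟P_ using (_∈?_)

  private
    module Q = Order (_≤Q_ σ)
    module OS = Order _≤S_
    module OP = Order _≤P_

  top bottom : |P| → |S|
  top p = e (p , true)
  bottom p = e (p , false)

  top-injective : ∀ {p q} → top p ≡ top q → p ≡ q
  top-injective tp≡tq = cong proj₁ (e-inj _ _ tp≡tq)

  bottom≢top : ∀ {p q} → bottom p ≢ top q
  bottom≢top bp≡tq with cong proj₂ (e-inj _ _ bp≡tq)
  ... | ()

  -- Kept ps s: s is not a point (q,b) with q ∉ ps, i.e. not one already deleted.
  Kept : List |P| → |S| → Set
  Kept ps s = ∀ q → s ≡ top q → q ∈ ps

  kept? : ∀ ps s → Dec (Kept ps s)
  kept? ps s = map′ (λ all q → All.lookup all (completeP q)) (λ kept → All.tabulate λ {q} _ → kept q)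
    (All.all? (λ q → (s ≟ top q) →-dec (q ∈? ps)) elemsP)

  Remaining : List |P| → Pred (Maybe |S|) 0ℓ
  Remaining ps y = Σ |S| λ s → y ≡ just s × Kept ps s

  remaining-complete : ∀ {ps} → (∀ p → p ∈ ps) → Remaining ps ≐ Q.Delete (AllQ σ) nothing
  remaining-complete {ps} complete = (λ { (_ , refl , _) → tt , λ () }) , ⊇
    where
    ⊇ : ∀ {y} → Q.Delete (AllQ σ) nothing y → Remaining ps y
    ⊇ {nothing} (_ , x≢x) = ⊥-elim (x≢x refl)
    ⊇ {just s} _ = s , refl , λ q _ → complete q

  remaining-[] : Remaining [] ≐ Target σ
  remaining-[] = (λ { (s , refl , kept) → s , refl , λ (q , s≡tq) → ¬Any[] (kept q s≡tq) })
               , (λ { (s , refl , ¬top) → s , refl , λ q s≡tq → ⊥-elim (¬top (q , s≡tq)) })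

  x-weakPoint : OP.Dismantlable (AllP P) → Q.WeakPoint (AllQ σ) nothing
  x-weakPoint dismantlable = tt , inj₂ (Tops.dismantlable-map above⊆ ⊆above dismantlable)
    where
    module Tops = OrderEmbedding _≤P_ (_≤Q_ σ) (λ p → just (top p))
      (λ tp≡tq → top-injective (just-injective tp≡tq))
      (λ p≤q → proj₂ (e-order _ _) (p≤q , tt))
      (λ tp≤tq → proj₁ (proj₁ (e-order _ _) tp≤tq))
    above⊆ : ∀ {y} → Q.Above (AllQ σ) nothing y → Σ |P| λ p → AllP P p × y ≡ just (top p)
    above⊆ {nothing} (_ , _ , x≢x) = ⊥-elim (x≢x refl)
    above⊆ {just s} (_ , (p , s≡tp) , _) = p , tt , cong just s≡tp
    ⊆above : ∀ {p} → AllP P p → Q.Above (AllQ σ) nothing (just (top p))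
    ⊆above {p} _ = tt , (p , refl) , λ ()

  module _ {p : |P|} {ps : List |P|} (p-minimal : All (λ q → ¬ q ≤P p) ps) where

    BelowTop : Pred |S| 0ℓ
    BelowTop s = Kept (p ∷ ps) s × s OS.< top p

    bottom-maxBelowTop : OS.HasMax BelowTop
    bottom-maxBelowTop =
      bottom p , ((λ _ bp≡tq → ⊥-elim (bottom≢top bp≡tq)) , bottom<top) , ≤bottom
      where
      bottom<top : bottom p OS.< top p
      bottom<top = proj₂ (e-order _ _) (≤P-refl p , tt) , bottom≢top
      ≤bottom : ∀ s → BelowTop s → s ≤S bottom p
      ≤bottom s (kept , s<tp) with proj₁ (below-pb p s) s<tp
      ... | (q , false) , refl , (q≤p , _) , _ = proj₂ (e-order _ _) (q≤p , tt)
      ... | (q , true) , refl , (q≤p , _) , q≢p with kept q refl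
      ...   | here q≡p = ⊥-elim (q≢p (cong (_, true) q≡p))
      ...   | there q∈ps = ⊥-elim (All.lookup p-minimal q∈ps q≤p)

    top-weakPoint : Q.WeakPoint (Remaining (p ∷ ps)) (just (top p))
    top-weakPoint = (top p , refl , λ q tp≡tq → here (sym (top-injective tp≡tq)))
                  , inj₁ (Just.dismantlable-map below⊆ ⊆below dismantlable-belowTop)
      where
      module Just = OrderEmbedding _≤S_ (_≤Q_ σ) just just-injective (λ s≤t → s≤t) (λ s≤t → s≤t)
      dismantlable-belowTop : OS.Dismantlable BelowTop
      dismantlable-belowTop = dismantlable-withMax S BelowTop
        (λ s → kept? (p ∷ ps) s ×-dec ((s ≤S? top p) ×-dec ¬? (s ≟ top p))) bottom-maxBelowTop
      below⊆ : ∀ {y} → Q.Below (Remaining (p ∷ ps)) (just (top p)) y → Σ |S| λ s → BelowTop s × y ≡ just s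
      below⊆ ((s , refl , kept) , s≤tp , s≢tp) = s , (kept , s≤tp , λ s≡tp → s≢tp (cong just s≡tp)) , refl
      ⊆below : ∀ {s} → BelowTop s → Q.Below (Remaining (p ∷ ps)) (just (top p)) (just s)
      ⊆below {s} (kept , s≤tp , s≢tp) = (s , refl , kept) , s≤tp , λ s≡tp → s≢tp (just-injective s≡tp)

    delete-top : Remaining ps ≐ Q.Delete (Remaining (p ∷ ps)) (just (top p))
    delete-top = ⊆ , ⊇
      where
      ⊆ : ∀ {y} → Remaining ps y → Q.Delete (Remaining (p ∷ ps)) (just (top p)) y
      ⊆ (s , refl , kept) = (s , refl , λ q s≡tq → there (kept q s≡tq))
                          , λ s≡tp → All.lookup p-minimal (kept p (just-injective s≡tp)) (≤P-refl p)
      ⊇ : ∀ {y} → Q.Delete (Remaining (p ∷ ps)) (just (top p)) y → Remaining ps y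
      ⊇ ((s , refl , kept) , s≢tp) = s , refl , kept′
        where
        kept′ : Kept ps s
        kept′ q s≡tq with kept q s≡tq
        ... | here q≡p = ⊥-elim (s≢tp (cong just (trans s≡tq (cong top q≡p))))
        ... | there q∈ps = q∈ps

  -- Linear extensions of P are the lists descending for the reversed order.
  open Linearisation (λ p q → q ≤P p) (λ p q → q ≤P? p) (λ q≤p r≤q → ≤P-trans r≤q q≤p)
    (λ q≤p p≤q → ≤P-antisym p≤q q≤p) _≟P_ using (Descending; linearise)

  linearExtension : Σ (List |P|) λ ps → (∀ p → p ∈ ps) × Descending ps
  linearExtension with linearise elemsP
  ... | ps , (_ , elems⊆ps) , descending = ps , (λ p → elems⊆ps (completeP p)) , descending

  deleteTops : ∀ ps → Descending ps → Q.WeakDeletions (Remaining ps) (Target σ)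
  deleteTops [] [] = Q.done remaining-[]
  deleteTops (p ∷ ps) (p-minimal ∷ descending) =
    Q.step (just (top p)) (top-weakPoint p-minimal)
      (weakDeletions-resp-≐ (_≤Q_ σ) (deleteTops ps descending) (delete-top p-minimal))

lemma3p3 : (P S : FinPoset) (σ : Setup P S) →
    Order.Dismantlable (FinPoset._≤_ P) (AllP P) →
    Order.WeakDeletions (_≤Q_ σ) (AllQ σ) (Target σ)
lemma3p3 P S σ dismantlable with linearExtension σ
... | ps , every∈ps , descending =
  Order.step nothing (x-weakPoint σ dismantlable)
    (weakDeletions-resp-≐ (_≤Q_ σ) (deleteTops σ ps descending) (remaining-complete σ every∈ps))
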